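{- Let $f\colon\{0,\dots,n\}\to\mathbb{Z}$ and $g\colon\{0,\dots,m\}\to\mathbb{Z}$, with $\Delta$ and $R_{2\Delta}$ as in the context. Let $I=\{i_A,\dots,i_B\}\subseteq\{0,\dots,n\}$ and $J=\{j_A,\dots,j_B\}\subseteq\{0,\dots,m\}$ be intervals of the same length $|I|=|J|$. If $I\times J\subseteq R_{2\Delta}$, then there are $a,b,c\in\mathbb{R}$ such that $|f(i)-(a\cdot i+b)|\le2\Delta$ for all $i\in I$ and $|g(j)-(a\cdot j+c)|\le2\Delta$ for all $j\in J$.
   Context: $\breve f$ is the pointwise maximal convex function $\{0,\dots,n\}\to\mathbb{Q}$ with $\breve f\le f$ (lower convex hull), similarly $\breve g$. $\Delta_f:=\max\{1,\max_i(f(i)-\breve f(i))\}$, $\Delta_g:=\max\{1,\max_j(g(j)-\breve g(j))\}$, $\Delta:=\max\{\Delta_f,\Delta_g\}$. $\breve h(k)=\min\{\breve f(i)+\breve g(j):i+j=k,\ 0\le i\le n,\ 0\le j\le m\}$. For $\delta\ge0$, a point $(i,j)\in\{0,\dots,n\}\times\{0,\dots,m\}$ is $\delta$-relevant if $\breve f(i)+\breve g(j)\le\breve h(i+j)+\delta$; $R_\delta$ is the set of $\delta$-relevant points. -}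

module Defs where

open import Data.Nat using (ℕ; zero; suc) renaming (_≤_ to _≤ℕ_; _+_ to _+ℕ_)
open import Data.Integer using (ℤ; +_)
open import Data.Rational using (ℚ; _/_; _+_; _-_; _*_; _⊔_; _≤_; 1ℚ)
open import Data.List using (List; map; foldr; upTo)
open import Relation.Binary.PropositionalEquality using (_≡_)

ℤ→ℚ : ℤ → ℚ
ℤ→ℚ z = z / 1

ℕ→ℚ : ℕ → ℚ
ℕ→ℚ k = (+ k) / 1

-- Functions on {0,…,n} are represented as functions on ℕ; only the values
-- at 0,…,n are ever consulted.

ConvexOn : ℕ → (ℕ → ℚ) → Set
ConvexOn n φ = ∀ i → suc (suc i) ≤ℕ n → φ (suc i) + φ (suc i) ≤ φ i + φ (suc (suc i))

BelowOn : ℕ → (ℕ → ℚ) → (ℕ → ℤ) → Set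
BelowOn n φ f = ∀ i → i ≤ℕ n → φ i ≤ ℤ→ℚ (f i)

IsLowerHull : ℕ → (ℕ → ℤ) → (ℕ → ℚ) → Set
IsLowerHull n f fb =
  ConvexOn n fb × BelowOn n fb f ×
  (∀ (φ : ℕ → ℚ) → ConvexOn n φ → BelowOn n φ f → ∀ i → i ≤ℕ n → φ i ≤ fb i)
  where open import Data.Product using (_×_)

DeltaOf : ℕ → (ℕ → ℤ) → (ℕ → ℚ) → ℚ
DeltaOf n f fb = foldr _⊔_ 1ℚ (map (λ i → ℤ→ℚ (f i) - fb i) (upTo (suc n)))

-- (i,j) ∈ {0..n}×{0..m} is δ-relevant:  fb(i)+gb(j) ≤ hb(i+j) + δ, where
-- hb(k) = min{ fb(i')+gb(j') : i'+j' = k, i' ≤ n, j' ≤ m }  (the minimum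
-- is attained, so "≤ min + δ" is unfolded to "≤ every candidate + δ").
Relevant : ℕ → ℕ → (ℕ → ℚ) → (ℕ → ℚ) → ℚ → ℕ → ℕ → Set
Relevant n m fb gb δ i j =
  i ≤ℕ n → j ≤ℕ m →
  ∀ i' j' → i' ≤ℕ n → j' ≤ℕ m → i' +ℕ j' ≡ i +ℕ j → fb i + gb j ≤ (fb i' + gb j') + δ

-- Shift both intervals to {0,…,L}. There the hulls F, G are convex and, by relevance, the sums
-- F t + G s along each antidiagonal t + s = const differ by at most E = 2Δ. At a split x + y = L
-- minimising F x + G y the one-sided slopes of F at x and of G at y interlace, so a single slope a
-- makes x a minimiser of F − a·id and y one of G − a·id. Comparing F t + G s with a pair through x,
-- and using that the tilted G only decreases towards its minimiser, traps F − a·id in a band of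
-- width E above its minimum (and likewise G). As f exceeds its hull by at most Δ, f − a·id lies in
-- a window of width 3Δ, whose middle line is within 2Δ of f.
module Submission where

open import Defs
open import Data.Nat using (ℕ) renaming (_≤_ to _≤ℕ_; _∸_ to _∸ℕ_)
open import Data.Integer using (ℤ)
open import Data.Rational using (ℚ; _+_; _-_; _*_; _⊔_; _≤_; ∣_∣)
open import Data.Product using (Σ; _×_)
open import Relation.Binary.PropositionalEquality using (_≡_)

open import Level using (0ℓ)
open import Data.Nat using (zero; suc; z≤n; s≤s) renaming (_+_ to _+ℕ_; _<_ to _<ℕ_)
import Data.Nat.Properties as ℕ
open import Algebra.Properties.CommutativeSemigroup ℕ.+-commutativeSemigroup using (x∙yz≈y∙xz; interchange)
open import Data.Integer using (+_)
open import Data.Rational using (-_; 0ℚ; 1ℚ; toℚᵘ)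
import Data.Rational.Properties as ℚ
import Data.Rational.Unnormalised as ℚᵘ
import Data.Rational.Unnormalised.Properties as ℚᵘ
import Data.Integer.Base as ℤ
import Data.Integer.Properties as ℤ
open import Data.List using (_∷_; []; map; foldr; upTo)
open import Data.List.Relation.Unary.Any using (here; there)
open import Data.List.Membership.Propositional using (_∈_)
open import Data.List.Membership.Propositional.Properties using (∈-map⁺; ∈-upTo⁺)
open import Data.Product using (_,_)
open import Data.Sum using (inj₁; inj₂)
open import Data.Empty using (⊥-elim)
open import Function using (flip)
open import Relation.Binary.Core using (Rel)
open import Relation.Binary.Definitions using (Reflexive; Transitive)
open import Relation.Binary.PropositionalEquality using (refl; sym; trans; cong; cong₂; subst)
open import Relation.Nullary.Decidable using (dec⇒maybe)
open import Tactic.RingSolver using (solve-∀)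
open import Tactic.RingSolver.Core.AlmostCommutativeRing using (AlmostCommutativeRing; fromCommutativeRing)

ℚ-ring : AlmostCommutativeRing 0ℓ 0ℓ
ℚ-ring = fromCommutativeRing ℚ.+-*-commutativeRing (λ x → dec⇒maybe (0ℚ ℚ.≟ x))

≤-rearrange : ∀ {p q x y : ℚ} → p ≤ q → x + q ≡ y + p → x ≤ y
≤-rearrange {p} {q} {x} {y} p≤q eq = begin
  x           ≡⟨ cancel x q ⟩
  (x + q) - q ≡⟨ cong (_- q) eq ⟩
  (y + p) - q ≤⟨ ℚ.+-monoˡ-≤ (- q) (ℚ.+-monoʳ-≤ y p≤q) ⟩
  (y + q) - q ≡⟨ sym (cancel y q) ⟩
  y           ∎
  where
  open ℚ.≤-Reasoning
  cancel : ∀ a b → a ≡ (a + b) - b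
  cancel = solve-∀ ℚ-ring

exchange-≤ : ∀ {p q r s : ℚ} → p + q ≤ r + s → p - r ≤ s - q
exchange-≤ {p} {q} {r} {s} h = ≤-rearrange h (identity p q r s)
  where
  identity : ∀ p q r s → (p - r) + (r + s) ≡ (s - q) + (p + q)
  identity = solve-∀ ℚ-ring

exchange-≤′ : ∀ {p q r s : ℚ} → p + q ≤ r + s → q - s ≤ r - p
exchange-≤′ {p} {q} {r} {s} h = ≤-rearrange h (identity p q r s)
  where
  identity : ∀ p q r s → (q - s) + (r + s) ≡ (r - p) + (p + q)
  identity = solve-∀ ℚ-ring

≤-cancel-+ : ∀ {p q u v e : ℚ} → p + u ≤ (q + v) + e → v ≤ u → p ≤ q + e
≤-cancel-+ {p} {q} {u} {v} {e} h v≤u = ≤-rearrange (ℚ.+-mono-≤ h v≤u) (identity p q u v e)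
  where
  identity : ∀ p q u v e → p + (((q + v) + e) + u) ≡ (q + e) + ((p + u) + v)
  identity = solve-∀ ℚ-ring

-q≤p≤q⇒∣p∣≤q : ∀ {p q : ℚ} → - q ≤ p → p ≤ q → ∣ p ∣ ≤ q
-q≤p≤q⇒∣p∣≤q {p} {q} -q≤p p≤q with ℚ.∣p∣≡p∨∣p∣≡-p p
... | inj₁ ∣p∣≡p  = subst (_≤ q) (sym ∣p∣≡p) p≤q
... | inj₂ ∣p∣≡-p = subst (_≤ q) (sym ∣p∣≡-p) (≤-rearrange -q≤p (identity p q))
  where
  identity : ∀ p q → - p + p ≡ q + - q
  identity = solve-∀ ℚ-ring

ℕ→ℚ-+ : ∀ m n → ℕ→ℚ (m +ℕ n) ≡ ℕ→ℚ m + ℕ→ℚ n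
ℕ→ℚ-+ m n = ℚ.toℚᵘ-injective (begin
  toℚᵘ (ℕ→ℚ (m +ℕ n))                         ≈⟨ as-ℚᵘ (m +ℕ n) ⟩
  ℚᵘ.mkℚᵘ (+ (m +ℕ n)) 0                       ≈⟨ ℚᵘ.*≡* (cong (ℤ._* + 1) +-homo) ⟩
  ℚᵘ.mkℚᵘ (+ m) 0 ℚᵘ.+ ℚᵘ.mkℚᵘ (+ n) 0         ≈⟨ ℚᵘ.+-cong (ℚᵘ.≃-sym (as-ℚᵘ m)) (ℚᵘ.≃-sym (as-ℚᵘ n)) ⟩
  toℚᵘ (ℕ→ℚ m) ℚᵘ.+ toℚᵘ (ℕ→ℚ n)               ≈⟨ ℚᵘ.≃-sym (ℚ.toℚᵘ-homo-+ (ℕ→ℚ m) (ℕ→ℚ n)) ⟩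
  toℚᵘ (ℕ→ℚ m + ℕ→ℚ n)                         ∎)
  where
  open ℚᵘ.≃-Reasoning
  as-ℚᵘ : ∀ k → toℚᵘ (ℕ→ℚ k) ℚᵘ.≃ ℚᵘ.mkℚᵘ (+ k) 0
  as-ℚᵘ k = ℚ.toℚᵘ-fromℚᵘ (ℚᵘ.mkℚᵘ (+ k) 0)
  +-homo : + (m +ℕ n) ≡ + m ℤ.* + 1 ℤ.+ + n ℤ.* + 1
  +-homo = sym (cong₂ ℤ._+_ (ℤ.*-identityʳ (+ m)) (ℤ.*-identityʳ (+ n)))

slope : (ℕ → ℚ) → ℕ → ℚ
slope φ i = φ (suc i) - φ i

tilt : ℚ → (ℕ → ℚ) → ℕ → ℚ
tilt a φ i = φ i - a * ℕ→ℚ i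

IsMinimumOn : ℕ → (ℕ → ℚ) → ℕ → Set
IsMinimumOn r φ x = ∀ {t} → t ≤ℕ r → φ x ≤ φ t

record IsLocalMinimumOn (r : ℕ) (φ : ℕ → ℚ) (x : ℕ) : Set where
  field
    ≤-next : suc x ≤ℕ r → φ x ≤ φ (suc x)
    ≤-prev : ∀ {k} → x ≡ suc k → φ x ≤ φ k

stepwise : ∀ {_∼_ : Rel ℚ 0ℓ} → Reflexive _∼_ → Transitive _∼_ → (φ : ℕ → ℚ) → ∀ {x y} →
  (∀ {i} → x ≤ℕ i → i <ℕ y → φ i ∼ φ (suc i)) → x ≤ℕ y → φ x ∼ φ y
stepwise ∼-refl ∼-trans φ {y = zero} step z≤n = ∼-refl
stepwise {_∼_} ∼-refl ∼-trans φ {x} {suc y} step x≤1+y with ℕ.m≤n⇒m<n∨m≡n x≤1+y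
... | inj₂ refl         = ∼-refl
... | inj₁ (s≤s x≤y) =
  ∼-trans {j = φ y}
    (stepwise {_∼_} ∼-refl ∼-trans φ (λ x≤i i<y → step x≤i (ℕ.m<n⇒m<1+n i<y)) x≤y)
    (step x≤y (ℕ.n<1+n y))

ascending : (φ : ℕ → ℚ) → ∀ {x y} → (∀ {i} → x ≤ℕ i → i <ℕ y → φ i ≤ φ (suc i)) → x ≤ℕ y → φ x ≤ φ y
ascending = stepwise {_≤_} ℚ.≤-refl ℚ.≤-trans

descending : (φ : ℕ → ℚ) → ∀ {x y} → (∀ {i} → x ≤ℕ i → i <ℕ y → φ (suc i) ≤ φ i) → x ≤ℕ y → φ y ≤ φ x
descending = stepwise {flip _≤_} ℚ.≤-refl (λ p q → ℚ.≤-trans q p)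

module _ {r : ℕ} {φ : ℕ → ℚ} (convex : ConvexOn r φ) where

  convex-slope-mono : ∀ {i} → suc (suc i) ≤ℕ r → slope φ i ≤ slope φ (suc i)
  convex-slope-mono {i} h = exchange-≤ {φ (suc i)} {φ (suc i)} {φ i} {φ (suc (suc i))} (convex i h)

  convex-ascent : ∀ {i} → suc (suc i) ≤ℕ r → φ i ≤ φ (suc i) → φ (suc i) ≤ φ (suc (suc i))
  convex-ascent {i} h up =
    ≤-rearrange (ℚ.+-mono-≤ (convex i h) up) (identity (φ i) (φ (suc i)) (φ (suc (suc i))))
    where
    identity : ∀ p q s → q + ((p + s) + q) ≡ s + ((q + q) + p)
    identity = solve-∀ ℚ-ring

  convex-descent : ∀ {i} → suc (suc i) ≤ℕ r → φ (suc (suc i)) ≤ φ (suc i) → φ (suc i) ≤ φ i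
  convex-descent {i} h down =
    ≤-rearrange (ℚ.+-mono-≤ (convex i h) down) (identity (φ i) (φ (suc i)) (φ (suc (suc i))))
    where
    identity : ∀ p q s → q + ((p + s) + q) ≡ p + ((q + q) + s)
    identity = solve-∀ ℚ-ring

  ascent-propagates : ∀ {x i} → φ x ≤ φ (suc x) → x ≤ℕ i → suc i ≤ℕ r → φ i ≤ φ (suc i)
  ascent-propagates {i = zero} up z≤n _ = up
  ascent-propagates {x} {suc i} up x≤1+i 1+i<r with ℕ.m≤n⇒m<n∨m≡n x≤1+i
  ... | inj₂ refl      = up
  ... | inj₁ (s≤s x≤i) = convex-ascent 1+i<r (ascent-propagates up x≤i (ℕ.<⇒≤ 1+i<r))

  descent-propagates : ∀ {x i} → suc x ≤ℕ r → φ (suc x) ≤ φ x → i ≤ℕ x → φ (suc i) ≤ φ i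
  descent-propagates {zero} _ down z≤n = down
  descent-propagates {suc x} x<r down i≤1+x with ℕ.m≤n⇒m<n∨m≡n i≤1+x
  ... | inj₂ refl      = down
  ... | inj₁ (s≤s i≤x) = descent-propagates (ℕ.<⇒≤ x<r) (convex-descent x<r down) i≤x

  local⇒global-minimum : ∀ {x} → x ≤ℕ r → IsLocalMinimumOn r φ x → IsMinimumOn r φ x
  local⇒global-minimum {x} x≤r local {t} t≤r with ℕ.≤-total x t
  ... | inj₁ x≤t = ascending φ ascends x≤t
    where
    open IsLocalMinimumOn local
    ascends : ∀ {i} → x ≤ℕ i → i <ℕ t → φ i ≤ φ (suc i)
    ascends {i} x≤i i<t = ascent-propagates {x} (≤-next (ℕ.≤-trans (s≤s x≤i) i<r)) x≤i i<r
      where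
      i<r : suc i ≤ℕ r
      i<r = ℕ.≤-trans i<t t≤r
  ... | inj₂ t≤x = descending φ descends t≤x
    where
    open IsLocalMinimumOn local
    descends : ∀ {i} → t ≤ℕ i → i <ℕ x → φ (suc i) ≤ φ i
    descends {i} _ (s≤s {n = k} i≤k) = descent-propagates {k} x≤r (≤-prev refl) i≤k

  minimum⇒antitone : ∀ {y} → y ≤ℕ r → IsMinimumOn r φ y → ∀ {i j} → i ≤ℕ j → j ≤ℕ y → φ j ≤ φ i
  minimum⇒antitone {y} y≤r minimum i≤j j≤y = descending φ (λ _ i<j → descends (ℕ.≤-trans i<j j≤y)) i≤j
    where
    descends : ∀ {i} → i <ℕ y → φ (suc i) ≤ φ i
    descends {i} i<y with ℚ.≤-total (φ i) (φ (suc i))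
    ... | inj₂ down = down
    ... | inj₁ up   = ℚ.≤-trans
      (ascending φ (λ i≤k k<y → ascent-propagates {i} up (ℕ.≤-trans (ℕ.n≤1+n i) i≤k) (ℕ.≤-trans k<y y≤r)) i<y)
      (minimum (ℕ.≤-trans (ℕ.<⇒≤ i<y) y≤r))

  minimum⇒monotone : ∀ {y} → IsMinimumOn r φ y → ∀ {i j} → y ≤ℕ i → i ≤ℕ j → j ≤ℕ r → φ i ≤ φ j
  minimum⇒monotone {y} minimum y≤i i≤j j≤r =
    ascending φ (λ i≤k k<j → ascends (ℕ.≤-trans y≤i i≤k) (ℕ.≤-trans k<j j≤r)) i≤j
    where
    ascends : ∀ {i} → y ≤ℕ i → suc i ≤ℕ r → φ i ≤ φ (suc i)
    ascends {i} y≤i i<r with ℚ.≤-total (φ i) (φ (suc i))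
    ... | inj₁ up   = up
    ... | inj₂ down = ℚ.≤-trans
      (descending φ (λ _ k<i → descent-propagates {i} i<r down (ℕ.<⇒≤ k<i)) y≤i)
      (minimum i<r)

module _ (a : ℚ) (φ : ℕ → ℚ) where

  private
    ℕ→ℚ-suc : ∀ n → ℕ→ℚ (suc n) ≡ 1ℚ + ℕ→ℚ n
    ℕ→ℚ-suc = ℕ→ℚ-+ 1

  tilt-convex : ∀ {r} → ConvexOn r φ → ConvexOn r (tilt a φ)
  tilt-convex convex i h rewrite ℕ→ℚ-suc (suc i) | ℕ→ℚ-suc i =
    ≤-rearrange (convex i h) (identity a (φ i) (φ (suc i)) (φ (suc (suc i))) (ℕ→ℚ i))
    where
    identity : ∀ a p q s n →
      ((q - a * (1ℚ + n)) + (q - a * (1ℚ + n))) + (p + s) ≡ ((p - a * n) + (s - a * (1ℚ + (1ℚ + n)))) + (q + q)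
    identity = solve-∀ ℚ-ring

  tilt-≤-next : ∀ {x} → a ≤ slope φ x → tilt a φ x ≤ tilt a φ (suc x)
  tilt-≤-next {x} h rewrite ℕ→ℚ-suc x = ≤-rearrange h (identity a (φ x) (φ (suc x)) (ℕ→ℚ x))
    where
    identity : ∀ a p q n → (p - a * n) + (q - p) ≡ (q - a * (1ℚ + n)) + a
    identity = solve-∀ ℚ-ring

  tilt-≤-prev : ∀ {k} → slope φ k ≤ a → tilt a φ (suc k) ≤ tilt a φ k
  tilt-≤-prev {k} h rewrite ℕ→ℚ-suc k = ≤-rearrange h (identity a (φ k) (φ (suc k)) (ℕ→ℚ k))
    where
    identity : ∀ a p q n → (q - a * (1ℚ + n)) + a ≡ (p - a * n) + (q - p)
    identity = solve-∀ ℚ-ring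

AntidiagonalSpread : ℕ → ℚ → (ℕ → ℚ) → (ℕ → ℚ) → Set
AntidiagonalSpread L E φ ψ = ∀ {t s t′ s′} → t ≤ℕ L → s ≤ℕ L → t′ ≤ℕ L → s′ ≤ℕ L →
  t +ℕ s ≡ t′ +ℕ s′ → φ t + ψ s ≤ (φ t′ + ψ s′) + E

spread-sym : ∀ {L E φ ψ} → AntidiagonalSpread L E φ ψ → AntidiagonalSpread L E ψ φ
spread-sym {E = E} {φ} {ψ} spread {s} {t} {s′} {t′} s≤L t≤L s′≤L t′≤L eq = begin
  ψ s + φ t         ≡⟨ ℚ.+-comm (ψ s) (φ t) ⟩
  φ t + ψ s         ≤⟨ spread t≤L s≤L t′≤L s′≤L (trans (ℕ.+-comm t s) (trans eq (ℕ.+-comm s′ t′))) ⟩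
  (φ t′ + ψ s′) + E ≡⟨ cong (_+ E) (ℚ.+-comm (φ t′) (ψ s′)) ⟩
  (ψ s′ + φ t′) + E ∎
  where open ℚ.≤-Reasoning

-- Tilting both functions by the same slope shifts every antidiagonal sum by the same amount.
spread-tilt : ∀ {L E φ ψ} a → AntidiagonalSpread L E φ ψ → AntidiagonalSpread L E (tilt a φ) (tilt a ψ)
spread-tilt {E = E} {φ} {ψ} a spread {t} {s} {t′} {s′} t≤L s≤L t′≤L s′≤L eq =
  ≤-rearrange (spread t≤L s≤L t′≤L s′≤L eq) (begin-equality
    (tilt a φ t + tilt a ψ s) + ((φ t′ + ψ s′) + E)
      ≡⟨ identity a E (φ t) (ψ s) (φ t′) (ψ s′) (ℕ→ℚ t) (ℕ→ℚ s) ⟩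
    ((φ t + ψ s + φ t′ + ψ s′) + E) - a * (ℕ→ℚ t + ℕ→ℚ s)
      ≡⟨ cong (λ n → ((φ t + ψ s + φ t′ + ψ s′) + E) - a * n) ℕ→ℚ-sums ⟩
    ((φ t + ψ s + φ t′ + ψ s′) + E) - a * (ℕ→ℚ t′ + ℕ→ℚ s′)
      ≡⟨ identity′ a E (φ t) (ψ s) (φ t′) (ψ s′) (ℕ→ℚ t′) (ℕ→ℚ s′) ⟩
    ((tilt a φ t′ + tilt a ψ s′) + E) + (φ t + ψ s) ∎)
  where
  open ℚ.≤-Reasoning
  ℕ→ℚ-sums : ℕ→ℚ t + ℕ→ℚ s ≡ ℕ→ℚ t′ + ℕ→ℚ s′
  ℕ→ℚ-sums = trans (sym (ℕ→ℚ-+ t s)) (trans (cong ℕ→ℚ eq) (ℕ→ℚ-+ t′ s′))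
  identity : ∀ a E p q p′ q′ n m →
    ((p - a * n) + (q - a * m)) + ((p′ + q′) + E) ≡ ((p + q + p′ + q′) + E) - a * (n + m)
  identity = solve-∀ ℚ-ring
  identity′ : ∀ a E p q p′ q′ n m →
    ((p + q + p′ + q′) + E) - a * (n + m) ≡ (((p′ - a * n) + (q′ - a * m)) + E) + (p + q)
  identity′ = solve-∀ ℚ-ring

-- Compare (t, 0) with (x, t − x) when t ≥ x, and (t, L) with (x, t + y) when t ≤ x;
-- in both cases the ψ-term moves towards the minimiser y, so it can only decrease.
spread-bound : ∀ {L E φ ψ x y} → ConvexOn L ψ → IsMinimumOn L ψ y → x +ℕ y ≡ L →
  AntidiagonalSpread L E φ ψ → ∀ {t} → t ≤ℕ L → φ t ≤ φ x + E
spread-bound {E = E} {φ} {x = x} {y} convex minimum refl spread {t} t≤L with ℕ.≤-total x t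
... | inj₁ x≤t with ℕ.m≤n⇒∃[o]m+o≡n x≤t
...   | d , refl = ≤-cancel-+ {q = φ x} {e = E}
  (spread t≤L z≤n x≤L (ℕ.≤-trans (ℕ.m≤n+m d x) t≤L) (ℕ.+-identityʳ (x +ℕ d)))
  (minimum⇒antitone convex y≤L minimum z≤n (ℕ.+-cancelˡ-≤ x d y t≤L))
  where
  x≤L : x ≤ℕ x +ℕ y
  x≤L = ℕ.m≤m+n x y
  y≤L : y ≤ℕ x +ℕ y
  y≤L = ℕ.m≤n+m y x
spread-bound {E = E} {φ} {x = x} {y} convex minimum refl spread {t} t≤L | inj₂ t≤x =
  ≤-cancel-+ {q = φ x} {e = E}
  (spread t≤L ℕ.≤-refl (ℕ.m≤m+n x y) t+y≤L (x∙yz≈y∙xz t x y))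
  (minimum⇒monotone convex minimum (ℕ.m≤n+m y t) t+y≤L ℕ.≤-refl)
  where
  t+y≤L : t +ℕ y ≤ℕ x +ℕ y
  t+y≤L = ℕ.+-monoˡ-≤ y t≤x

antidiagonal-argmin : (H : ℕ → ℕ → ℚ) (L : ℕ) →
  Σ ℕ λ x → Σ ℕ λ y → x +ℕ y ≡ L × (∀ {x′ y′} → x′ +ℕ y′ ≡ L → H x y ≤ H x′ y′)
antidiagonal-argmin H zero = 0 , 0 , refl , minimal
  where
  minimal : ∀ {x′ y′} → x′ +ℕ y′ ≡ 0 → H 0 0 ≤ H x′ y′
  minimal {zero} {zero} _ = ℚ.≤-refl
antidiagonal-argmin H (suc L) with antidiagonal-argmin (λ k l → H k (suc l)) L
... | x , y , x+y≡L , minimal with ℚ.≤-total (H x (suc y)) (H (suc L) 0)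
...   | inj₁ below = x , suc y , trans (ℕ.+-suc x y) (cong suc x+y≡L) , minimal′
  where
  minimal′ : ∀ {x′ y′} → x′ +ℕ y′ ≡ suc L → H x (suc y) ≤ H x′ y′
  minimal′ {x′} {zero} eq rewrite ℕ.+-identityʳ x′ | eq = below
  minimal′ {x′} {suc y′} eq = minimal (ℕ.suc-injective (trans (sym (ℕ.+-suc x′ y′)) eq))
...   | inj₂ above = suc L , 0 , cong suc (ℕ.+-identityʳ L) , minimal′
  where
  minimal′ : ∀ {x′ y′} → x′ +ℕ y′ ≡ suc L → H (suc L) 0 ≤ H x′ y′
  minimal′ {x′} {zero} eq rewrite ℕ.+-identityʳ x′ | eq = ℚ.≤-refl
  minimal′ {x′} {suc y′} eq = ℚ.≤-trans above (minimal (ℕ.suc-injective (trans (sym (ℕ.+-suc x′ y′)) eq)))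

-- At a minimising split x + y = L, the left slopes of F at x and of G at y are bounded by the
-- right slopes of both (exchange one unit between x and y), so one slope a fits all four.
common-subgradient : ∀ {L F G x y} → ConvexOn L F → ConvexOn L G → x +ℕ y ≡ L →
  (∀ {x′ y′} → x′ +ℕ y′ ≡ L → F x + G y ≤ F x′ + G y′) →
  Σ ℚ λ a → IsLocalMinimumOn L (tilt a F) x × IsLocalMinimumOn L (tilt a G) y
common-subgradient {F = F} {G} {suc x} {suc y} convexF convexG refl optimal =
  a , record { ≤-next = λ h → tilt-≤-next a F (ℚ.⊔-lub (convex-slope-mono {φ = F} convexF h) G≤F)
             ; ≤-prev = λ { refl → tilt-≤-prev a F (ℚ.p≤p⊔q (slope F x) (slope G y)) } }
    , record { ≤-next = λ h → tilt-≤-next a G (ℚ.⊔-lub F≤G (convex-slope-mono {φ = G} convexG h))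
             ; ≤-prev = λ { refl → tilt-≤-prev a G (ℚ.p≤q⊔p (slope F x) (slope G y)) } }
  where
  a : ℚ
  a = slope F x ⊔ slope G y
  F≤G : slope F x ≤ slope G (suc y)
  F≤G = exchange-≤ {F (suc x)} {G (suc y)} {F x} {G (suc (suc y))}
          (optimal {x} {suc (suc y)} (ℕ.+-suc x (suc y)))
  G≤F : slope G y ≤ slope F (suc x)
  G≤F = exchange-≤′ {F (suc x)} {G (suc y)} {F (suc (suc x))} {G y}
          (optimal {suc (suc x)} {y} (cong suc (sym (ℕ.+-suc x y))))
common-subgradient {F = F} {G} {suc x} {zero} convexF convexG refl optimal =
  slope F x
    , record { ≤-next = λ h → ⊥-elim (ℕ.<-irrefl (sym (ℕ.+-identityʳ (suc x))) h)
             ; ≤-prev = λ { refl → tilt-≤-prev (slope F x) F ℚ.≤-refl } }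
    , record { ≤-next = λ _ → tilt-≤-next (slope F x) G
                 (exchange-≤ {F (suc x)} {G 0} {F x} {G 1} (optimal {x} {1} (ℕ.+-suc x 0)))
             ; ≤-prev = λ () }
common-subgradient {F = F} {G} {zero} {suc y} convexF convexG refl optimal =
  slope G y
    , record { ≤-next = λ _ → tilt-≤-next (slope G y) F
                 (exchange-≤′ {F 0} {G (suc y)} {F 1} {G y} (optimal {1} {y} refl))
             ; ≤-prev = λ () }
    , record { ≤-next = λ h → ⊥-elim (ℕ.<-irrefl refl h)
             ; ≤-prev = λ { refl → tilt-≤-prev (slope G y) G ℚ.≤-refl } }
common-subgradient {x = zero} {zero} convexF convexG refl optimal =
  0ℚ , record { ≤-next = λ () ; ≤-prev = λ () } , record { ≤-next = λ () ; ≤-prev = λ () }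

WithinBand : ℕ → ℚ → (ℕ → ℚ) → ℚ → ℚ → Set
WithinBand L E φ a p = ∀ {t} → t ≤ℕ L → p ≤ tilt a φ t × tilt a φ t ≤ p + E

convex-pair-band : ∀ {L E F G} → ConvexOn L F → ConvexOn L G → AntidiagonalSpread L E F G →
  Σ ℚ λ a → Σ ℚ λ p → Σ ℚ λ q → WithinBand L E F a p × WithinBand L E G a q
convex-pair-band {L} {E} {F} {G} convexF convexG spread
  with antidiagonal-argmin (λ k l → F k + G l) L
... | x , y , x+y≡L , optimal with common-subgradient {F = F} {G} convexF convexG x+y≡L optimal
...   | a , localF , localG =
  a , tilt a F x , tilt a G y
    , (λ t≤L → minimumF t≤L , spread-bound {φ = tilt a F} convexG′ minimumG x+y≡L spread′ t≤L)
    , (λ t≤L → minimumG t≤L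
               , spread-bound {φ = tilt a G} convexF′ minimumF y+x≡L (spread-sym {φ = tilt a F} spread′) t≤L)
  where
  y+x≡L : y +ℕ x ≡ L
  y+x≡L = trans (ℕ.+-comm y x) x+y≡L
  convexF′ : ConvexOn L (tilt a F)
  convexF′ = tilt-convex a F convexF
  convexG′ : ConvexOn L (tilt a G)
  convexG′ = tilt-convex a G convexG
  spread′ : AntidiagonalSpread L E (tilt a F) (tilt a G)
  spread′ = spread-tilt {φ = F} {G} a spread
  minimumF : IsMinimumOn L (tilt a F) x
  minimumF = local⇒global-minimum {φ = tilt a F} convexF′ (subst (x ≤ℕ_) x+y≡L (ℕ.m≤m+n x y)) localF
  minimumG : IsMinimumOn L (tilt a G) y
  minimumG = local⇒global-minimum {φ = tilt a G} convexG′ (subst (y ≤ℕ_) y+x≡L (ℕ.m≤m+n y x)) localG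

foldr-⊔-member : ∀ {x : ℚ} {xs} e → x ∈ xs → x ≤ foldr _⊔_ e xs
foldr-⊔-member e (here refl)          = ℚ.p≤p⊔q _ _
foldr-⊔-member {xs = y ∷ _} e (there x∈xs) = ℚ.≤-trans (foldr-⊔-member e x∈xs) (ℚ.p≤q⊔p y _)

foldr-⊔-init : ∀ e xs → e ≤ foldr _⊔_ e xs
foldr-⊔-init e []       = ℚ.≤-refl
foldr-⊔-init e (y ∷ ys) = ℚ.≤-trans (foldr-⊔-init e ys) (ℚ.p≤q⊔p y _)

gap≤DeltaOf : ∀ {n} f fb {i} → i ≤ℕ n → ℤ→ℚ (f i) - fb i ≤ DeltaOf n f fb
gap≤DeltaOf f fb i≤n = foldr-⊔-member 1ℚ (∈-map⁺ (λ i → ℤ→ℚ (f i) - fb i) (∈-upTo⁺ (s≤s i≤n)))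

0≤DeltaOf : ∀ n f fb → 0ℚ ≤ DeltaOf n f fb
0≤DeltaOf n f fb = ℚ.≤-trans (ℚ.≤ᵇ⇒≤ _) (foldr-⊔-init 1ℚ (map (λ i → ℤ→ℚ (f i) - fb i) (upTo (suc n))))

shift-convex : ∀ {n φ k L} → ConvexOn n φ → k +ℕ L ≤ℕ n → ConvexOn L (λ t → φ (k +ℕ t))
shift-convex {n} {φ} {k} {L} convex kL≤n i h rewrite ℕ.+-suc k (suc i) | ℕ.+-suc k i =
  convex (k +ℕ i) (ℕ.≤-trans (subst (_≤ℕ k +ℕ L) k+2+i≡2+k+i (ℕ.+-monoʳ-≤ k h)) kL≤n)
  where
  k+2+i≡2+k+i : k +ℕ suc (suc i) ≡ suc (suc (k +ℕ i))
  k+2+i≡2+k+i = trans (ℕ.+-suc k (suc i)) (cong suc (ℕ.+-suc k i))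

relevant⇒spread : ∀ {n m fb gb E k l L} → k +ℕ L ≤ℕ n → l +ℕ L ≤ℕ m →
  (∀ i j → k ≤ℕ i → i ≤ℕ k +ℕ L → l ≤ℕ j → j ≤ℕ l +ℕ L → Relevant n m fb gb E i j) →
  AntidiagonalSpread L E (λ t → fb (k +ℕ t)) (λ s → gb (l +ℕ s))
relevant⇒spread {k = k} {l} kL≤n lL≤m relevant {t} {s} {t′} {s′} t≤L s≤L t′≤L s′≤L eq =
  relevant (k +ℕ t) (l +ℕ s) (ℕ.m≤m+n k t) (ℕ.+-monoʳ-≤ k t≤L) (ℕ.m≤m+n l s) (ℕ.+-monoʳ-≤ l s≤L)
    (inside kL≤n t≤L) (inside lL≤m s≤L) (k +ℕ t′) (l +ℕ s′) (inside kL≤n t′≤L) (inside lL≤m s′≤L)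
    (begin
      (k +ℕ t′) +ℕ (l +ℕ s′) ≡⟨ interchange k t′ l s′ ⟩
      (k +ℕ l) +ℕ (t′ +ℕ s′) ≡⟨ cong ((k +ℕ l) +ℕ_) (sym eq) ⟩
      (k +ℕ l) +ℕ (t +ℕ s)   ≡⟨ interchange k l t s ⟩
      (k +ℕ t) +ℕ (l +ℕ s)   ∎)
  where
  open Relation.Binary.PropositionalEquality.≡-Reasoning
  inside : ∀ {a b c N} → a +ℕ b ≤ℕ N → c ≤ℕ b → a +ℕ c ≤ℕ N
  inside {a} ab≤N c≤b = ℕ.≤-trans (ℕ.+-monoʳ-≤ a c≤b) ab≤N

-- For i = c + n and b = p + D − a c, the error f − (a i + b) is (f − h) + (h − a n − p) − D,
-- whose first two summands lie in [0, D] and [0, 2D].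
band-fit : ∀ {D fi h a n c p : ℚ} → 0ℚ ≤ D → h ≤ fi → fi - h ≤ D → p ≤ h - a * n → h - a * n ≤ p + (D + D) →
  ∣ fi - (a * (c + n) + ((p + D) - a * c)) ∣ ≤ D + D
band-fit {D} {fi} {h} {a} {n} {c} {p} 0≤D h≤fi gap≤D lower upper = -q≤p≤q⇒∣p∣≤q
  (≤-rearrange (ℚ.+-mono-≤ (ℚ.+-mono-≤ h≤fi lower) 0≤D) (below D fi h a n c p))
  (≤-rearrange (ℚ.+-mono-≤ gap≤D upper) (above D fi h a n c p))
  where
  below : ∀ D fi h a n c p →
    - (D + D) + ((fi + (h - a * n)) + D) ≡ (fi - (a * (c + n) + ((p + D) - a * c))) + ((h + p) + 0ℚ)
  below = solve-∀ ℚ-ring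
  above : ∀ D fi h a n c p →
    (fi - (a * (c + n) + ((p + D) - a * c))) + (D + (p + (D + D))) ≡ (D + D) + ((fi - h) + (h - a * n))
  above = solve-∀ ℚ-ring

band⇒line-fit : ∀ {n k L D a p} (f : ℕ → ℤ) (fb : ℕ → ℚ) → BelowOn n fb f →
  (∀ {i} → i ≤ℕ n → ℤ→ℚ (f i) - fb i ≤ D) → 0ℚ ≤ D → k +ℕ L ≤ℕ n →
  WithinBand L (D + D) (λ t → fb (k +ℕ t)) a p →
  ∀ i → k ≤ℕ i → i ≤ℕ k +ℕ L → ∣ ℤ→ℚ (f i) - (a * ℕ→ℚ i + ((p + D) - a * ℕ→ℚ k)) ∣ ≤ D + D
band⇒line-fit {n} {k} {L} {D} {a} {p} f fb fb≤f gap 0≤D kL≤n band i k≤i i≤k+L with ℕ.m≤n⇒∃[o]m+o≡n k≤i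
... | t , refl with band (ℕ.+-cancelˡ-≤ k t L i≤k+L)
...   | lower , upper rewrite ℕ→ℚ-+ k t =
  band-fit {D} {ℤ→ℚ (f (k +ℕ t))} {fb (k +ℕ t)} {a} {ℕ→ℚ t} {ℕ→ℚ k} {p}
    0≤D (fb≤f (k +ℕ t) i≤n) (gap i≤n) lower upper
  where
  i≤n : k +ℕ t ≤ℕ n
  i≤n = ℕ.≤-trans i≤k+L kL≤n

convex-pair-line-fit : ∀ {n m f g fb gb D} →
  ConvexOn n fb → BelowOn n fb f → ConvexOn m gb → BelowOn m gb g →
  (∀ {i} → i ≤ℕ n → ℤ→ℚ (f i) - fb i ≤ D) → (∀ {j} → j ≤ℕ m → ℤ→ℚ (g j) - gb j ≤ D) → 0ℚ ≤ D →
  ∀ {k l L} → k +ℕ L ≤ℕ n → l +ℕ L ≤ℕ m →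
  (∀ i j → k ≤ℕ i → i ≤ℕ k +ℕ L → l ≤ℕ j → j ≤ℕ l +ℕ L → Relevant n m fb gb (D + D) i j) →
  Σ ℚ λ a → Σ ℚ λ b → Σ ℚ λ c →
    (∀ i → k ≤ℕ i → i ≤ℕ k +ℕ L → ∣ ℤ→ℚ (f i) - (a * ℕ→ℚ i + b) ∣ ≤ D + D) ×
    (∀ j → l ≤ℕ j → j ≤ℕ l +ℕ L → ∣ ℤ→ℚ (g j) - (a * ℕ→ℚ j + c) ∣ ≤ D + D)
convex-pair-line-fit {n} {m} {f} {g} {fb} {gb} {D} convexf fb≤f convexg gb≤g gapf gapg 0≤D {k} {l} {L}
  kL≤n lL≤m relevant = let (a , p , q , bandF , bandG) = band in
    a , (p + D) - a * ℕ→ℚ k , (q + D) - a * ℕ→ℚ l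
      , band⇒line-fit {n} {k} {L} {D} {a} {p} f fb fb≤f gapf 0≤D kL≤n bandF
      , band⇒line-fit {m} {l} {L} {D} {a} {q} g gb gb≤g gapg 0≤D lL≤m bandG
  where
  band : Σ ℚ λ a → Σ ℚ λ p → Σ ℚ λ q →
    WithinBand L (D + D) (λ t → fb (k +ℕ t)) a p × WithinBand L (D + D) (λ s → gb (l +ℕ s)) a q
  band = convex-pair-band {L} {D + D} {λ t → fb (k +ℕ t)} {λ s → gb (l +ℕ s)}
         (shift-convex {n} {fb} {k} {L} convexf kL≤n) (shift-convex {m} {gb} {l} {L} convexg lL≤m)
         (relevant⇒spread {n} {m} {fb} {gb} {D + D} {k} {l} {L} kL≤n lL≤m relevant)

lemma4p8 : (n m : ℕ) (f g : ℕ → ℤ) (fb gb : ℕ → ℚ) →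
    IsLowerHull n f fb → IsLowerHull m g gb →
    (iA iB jA jB : ℕ) → iA ≤ℕ iB → iB ≤ℕ n → jA ≤ℕ jB → jB ≤ℕ m →
    iB ∸ℕ iA ≡ jB ∸ℕ jA →
    (∀ i j → iA ≤ℕ i → i ≤ℕ iB → jA ≤ℕ j → j ≤ℕ jB →
      Relevant n m fb gb ((DeltaOf n f fb ⊔ DeltaOf m g gb) + (DeltaOf n f fb ⊔ DeltaOf m g gb)) i j) →
    Σ ℚ λ a → Σ ℚ λ b → Σ ℚ λ c →
      (∀ i → iA ≤ℕ i → i ≤ℕ iB →
        ∣ ℤ→ℚ (f i) - (a * ℕ→ℚ i + b) ∣ ≤ (DeltaOf n f fb ⊔ DeltaOf m g gb) + (DeltaOf n f fb ⊔ DeltaOf m g gb)) ×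
      (∀ j → jA ≤ℕ j → j ≤ℕ jB →
        ∣ ℤ→ℚ (g j) - (a * ℕ→ℚ j + c) ∣ ≤ (DeltaOf n f fb ⊔ DeltaOf m g gb) + (DeltaOf n f fb ⊔ DeltaOf m g gb))
lemma4p8 n m f g fb gb (convexf , fb≤f , _) (convexg , gb≤g , _) iA iB jA jB iA≤iB iB≤n jA≤jB jB≤m
  lengths relevant
  with ℕ.m≤n⇒∃[o]m+o≡n iA≤iB | ℕ.m≤n⇒∃[o]m+o≡n jA≤jB
... | L , refl | L′ , refl with trans (sym (ℕ.m+n∸m≡n iA L)) (trans lengths (ℕ.m+n∸m≡n jA L′))
...   | refl = convex-pair-line-fit {n} {m} {f} {g} {fb} {gb} {D}
                 convexf fb≤f convexg gb≤g gapf gapg 0≤D {iA} {jA} {L} iB≤n jB≤m relevant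
  where
  D : ℚ
  D = DeltaOf n f fb ⊔ DeltaOf m g gb
  gapf : ∀ {i} → i ≤ℕ n → ℤ→ℚ (f i) - fb i ≤ D
  gapf i≤n = ℚ.≤-trans (gap≤DeltaOf {n} f fb i≤n) (ℚ.p≤p⊔q _ _)
  gapg : ∀ {j} → j ≤ℕ m → ℤ→ℚ (g j) - gb j ≤ D
  gapg j≤m = ℚ.≤-trans (gap≤DeltaOf {m} g gb j≤m) (ℚ.p≤q⊔p (DeltaOf n f fb) _)
  0≤D : 0ℚ ≤ D
  0≤D = ℚ.≤-trans (0≤DeltaOf n f fb) (ℚ.p≤p⊔q _ _)
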